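{- In every c-lattice, with $d(x)=(x\cdot 1_\pi)\|1_\sigma$, for all $x$: (1) $d(x)=1_\sigma\sqcap((x\cdot 1_\pi)\|\overline{1}_\pi)$; (2) $d(x)=1_\sigma\sqcap((x\cdot 1_\pi)\|U)$; (3) $d(x)=(1_\pi\sqcap x\cdot U)\|1_\sigma$.
   Context: A proto-trioid is $(S,+,\cdot,\|,0,1_\sigma,1_\pi)$ where $(S,+,0)$ is a join semilattice with least element $0$ (order $x\le y\iff x+y=y$); $1_\sigma\cdot x=x=x\cdot 1_\sigma$; $x\cdot y+x\cdot z\le x\cdot(y+z)$; $(x+y)\cdot z=x\cdot z+y\cdot z$; $0\cdot x=0$; $\|$ is associative and commutative with unit $1_\pi$, distributes over $+$, and $0\|x=0$. A c-lattice is a structure $(S,+,\sqcap,\cdot,\|,0,1_\sigma,1_\pi,U,\overline{1}_\pi)$ such that $(S,+,\sqcap,0,U)$ is a bounded distributive lattice with least element $0$ and greatest element $U$, $(S,+,\cdot,\|,0,1_\sigma,1_\pi)$ is a proto-trioid, and for all $x,y,z$: (cl1) $x\cdot 1_\pi+x\cdot\overline{1}_\pi=x\cdot U$; (cl2) $1_\pi\sqcap(x+\overline{1}_\pi)=x\cdot 0$; (cl3) $x\cdot(y\|z)\le(x\cdot y)\|(x\cdot z)$; (cl4) $z\|z\le z\Rightarrow (x\|y)\cdot z=(x\cdot z)\|(y\cdot z)$; (cl5) $x\cdot(y\cdot(z\cdot 0))=(x\cdot y)\cdot(z\cdot 0)$; (cl6) $(x\cdot 0)\cdot y=x\cdot(0\cdot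 y)$; (cl7) $1_\sigma\|1_\sigma=1_\sigma$; (cl8) $((x\cdot 1_\pi)\|1_\sigma)\cdot y=(x\cdot 1_\pi)\|y$; (cl9) $((x\sqcap 1_\sigma)\cdot 1_\pi)\|1_\sigma=x\sqcap 1_\sigma$; (cl10) $((x\sqcap\overline{1}_\pi)\cdot 1_\pi)\|1_\sigma=1_\sigma\sqcap((x\sqcap\overline{1}_\pi)\cdot\overline{1}_\pi)$; (cl11) $((x\sqcap\overline{1}_\pi)\cdot 1_\pi)\|\overline{1}_\pi=(x\sqcap\overline{1}_\pi)\cdot\overline{1}_\pi$. In the claim, $\cdot$ binds more tightly than $\sqcap$. -}

module Defs where

open import Level using (Level; suc)
open import Relation.Binary.PropositionalEquality using (_≡_)

record CLattice (a : Level) : Set (suc a) where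
  infixl 6 _+_
  infixl 5 _⊓_
  infixl 8 _·_
  infixl 7 _∥_
  infix 4 _≤_
  field
    S    : Set a
    _+_  : S → S → S
    _⊓_  : S → S → S
    _·_  : S → S → S
    _∥_  : S → S → S
    𝟘    : S
    1σ   : S
    1π   : S
    U    : S
    1π̄   : S

  _≤_ : S → S → Set a
  x ≤ y = x + y ≡ y

  field
    +-assoc   : ∀ x y z → (x + y) + z ≡ x + (y + z)
    +-comm    : ∀ x y → x + y ≡ y + x
    +-idem    : ∀ x → x + x ≡ x
    ⊓-assoc   : ∀ x y z → (x ⊓ y) ⊓ z ≡ x ⊓ (y ⊓ z)
    ⊓-comm    : ∀ x y → x ⊓ y ≡ y ⊓ x
    ⊓-idem    : ∀ x → x ⊓ x ≡ x
    absorb-+⊓ : ∀ x y → x + (x ⊓ y) ≡ x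
    absorb-⊓+ : ∀ x y → x ⊓ (x + y) ≡ x
    distrib   : ∀ x y z → x ⊓ (y + z) ≡ (x ⊓ y) + (x ⊓ z)
    +-identity : ∀ x → 𝟘 + x ≡ x
    ⊓-top      : ∀ x → U ⊓ x ≡ x
    ·-identityˡ : ∀ x → 1σ · x ≡ x
    ·-identityʳ : ∀ x → x · 1σ ≡ x
    ·-subdistribˡ : ∀ x y z → x · y + x · z ≤ x · (y + z)
    ·-distribʳ    : ∀ x y z → (x + y) · z ≡ x · z + y · z
    ·-zeroˡ       : ∀ x → 𝟘 · x ≡ 𝟘
    ∥-assoc    : ∀ x y z → (x ∥ y) ∥ z ≡ x ∥ (y ∥ z)
    ∥-comm     : ∀ x y → x ∥ y ≡ y ∥ x
    ∥-identity : ∀ x → 1π ∥ x ≡ x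
    ∥-distrib  : ∀ x y z → x ∥ (y + z) ≡ x ∥ y + x ∥ z
    ∥-zero     : ∀ x → 𝟘 ∥ x ≡ 𝟘
    cl1  : ∀ x → x · 1π + x · 1π̄ ≡ x · U
    cl2  : ∀ x → 1π ⊓ (x + 1π̄) ≡ x · 𝟘
    cl3  : ∀ x y z → x · (y ∥ z) ≤ (x · y) ∥ (x · z)
    cl4  : ∀ x y z → z ∥ z ≤ z → (x ∥ y) · z ≡ (x · z) ∥ (y · z)
    cl5  : ∀ x y z → x · (y · (z · 𝟘)) ≡ (x · y) · (z · 𝟘)
    cl6  : ∀ x y → (x · 𝟘) · y ≡ x · (𝟘 · y)
    cl7  : 1σ ∥ 1σ ≡ 1σ
    cl8  : ∀ x y → ((x · 1π) ∥ 1σ) · y ≡ (x · 1π) ∥ y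
    cl9  : ∀ x → ((x ⊓ 1σ) · 1π) ∥ 1σ ≡ x ⊓ 1σ
    cl10 : ∀ x → ((x ⊓ 1π̄) · 1π) ∥ 1σ ≡ 1σ ⊓ ((x ⊓ 1π̄) · 1π̄)
    cl11 : ∀ x → ((x ⊓ 1π̄) · 1π) ∥ 1π̄ ≡ (x ⊓ 1π̄) · 1π̄

  d : S → S
  d x = (x · 1π) ∥ 1σ

-- Everything rests on two order facts: x · 1π ≤ 1π (since x · 1π is fixed by · 𝟘, and cl2 puts every
-- y · 𝟘 below 1π), hence d x ≤ 1σ; and 1σ ≤ 1π̄ (1σ is disjoint from 1π and U = 1π + 1π̄).
-- Then d x ≤ 1π̄, so cl10 applied to d x gives (1); splitting U = 1π + 1π̄ and discarding the part
-- x · 1π, disjoint from 1σ, turns (1) into (2). For (3), x · U = x · 1π + x · 1π̄ by cl1, and the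
-- part of x · 1π̄ below 1π is below x · 𝟘 ≤ x · 1π.
module Submission where

open import Defs
open import Level using (Level)
open import Data.Product using (_×_; _,_)
open import Relation.Binary.PropositionalEquality
  using (_≡_; sym; trans; cong; cong₂; subst; module ≡-Reasoning)

module CLatticeProperties {a : Level} (C : CLattice a) where
  open CLattice C
  open ≡-Reasoning

  ≤-trans : ∀ {x y z} → x ≤ y → y ≤ z → x ≤ z
  ≤-trans {x} {y} {z} x≤y y≤z = begin
    x + z        ≡⟨ cong (x +_) (sym y≤z) ⟩
    x + (y + z)  ≡⟨ sym (+-assoc x y z) ⟩
    (x + y) + z  ≡⟨ cong (_+ z) x≤y ⟩
    y + z        ≡⟨ y≤z ⟩
    z            ∎

  ≤-respˡ-≡ : ∀ {x y z} → x ≡ y → x ≤ z → y ≤ z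
  ≤-respˡ-≡ {z = z} = subst (_≤ z)

  ≤-respʳ-≡ : ∀ {x y z} → y ≡ z → x ≤ y → x ≤ z
  ≤-respʳ-≡ {x} = subst (x ≤_)

  x≤x+y : ∀ x y → x ≤ x + y
  x≤x+y x y = trans (sym (+-assoc x x y)) (cong (_+ y) (+-idem x))

  x⊓y≤x : ∀ x y → x ⊓ y ≤ x
  x⊓y≤x x y = trans (+-comm (x ⊓ y) x) (absorb-+⊓ x y)

  x≤y⇒x⊓y≡x : ∀ {x y} → x ≤ y → x ⊓ y ≡ x
  x≤y⇒x⊓y≡x {x} {y} x≤y = trans (cong (x ⊓_) (sym x≤y)) (absorb-⊓+ x y)

  x⊓y≡x⇒x≤y : ∀ {x y} → x ⊓ y ≡ x → x ≤ y
  x⊓y≡x⇒x≤y {x} {y} x⊓y≡x = begin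
    x + y        ≡⟨ cong (_+ y) (sym x⊓y≡x) ⟩
    (x ⊓ y) + y  ≡⟨ +-comm (x ⊓ y) y ⟩
    y + (x ⊓ y)  ≡⟨ cong (y +_) (⊓-comm x y) ⟩
    y + (y ⊓ x)  ≡⟨ absorb-+⊓ y x ⟩
    y            ∎

  x≤𝟘⇒x≡𝟘 : ∀ {x} → x ≤ 𝟘 → x ≡ 𝟘
  x≤𝟘⇒x≡𝟘 {x} = trans (sym (trans (+-comm x 𝟘) (+-identity x)))

  ⊓-monoʳ-≤ : ∀ x {y z} → y ≤ z → x ⊓ y ≤ x ⊓ z
  ⊓-monoʳ-≤ x {y} {z} y≤z = trans (sym (distrib x y z)) (cong (x ⊓_) y≤z)

  ⊓≡𝟘-antimonoʳ : ∀ {x y z} → y ≤ z → x ⊓ z ≡ 𝟘 → x ⊓ y ≡ 𝟘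
  ⊓≡𝟘-antimonoʳ {x} y≤z x⊓z≡𝟘 = x≤𝟘⇒x≡𝟘 (≤-respʳ-≡ x⊓z≡𝟘 (⊓-monoʳ-≤ x y≤z))

  ⊓-+-disjointˡ : ∀ {x y} z → x ⊓ y ≡ 𝟘 → x ⊓ (y + z) ≡ x ⊓ z
  ⊓-+-disjointˡ {x} {y} z x⊓y≡𝟘 = begin
    x ⊓ (y + z)            ≡⟨ distrib x y z ⟩
    (x ⊓ y) + (x ⊓ z)      ≡⟨ cong (_+ (x ⊓ z)) x⊓y≡𝟘 ⟩
    𝟘 + (x ⊓ z)            ≡⟨ +-identity (x ⊓ z) ⟩
    x ⊓ z                  ∎

  ∥-identityʳ : ∀ x → x ∥ 1π ≡ x
  ∥-identityʳ x = trans (∥-comm x 1π) (∥-identity x)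

  ∥-monoˡ-≤ : ∀ {x y} z → x ≤ y → x ∥ z ≤ y ∥ z
  ∥-monoˡ-≤ {x} {y} z x≤y = begin
    x ∥ z + y ∥ z  ≡⟨ cong₂ _+_ (∥-comm x z) (∥-comm y z) ⟩
    z ∥ x + z ∥ y  ≡⟨ sym (∥-distrib z x y) ⟩
    z ∥ (x + y)    ≡⟨ cong (z ∥_) x≤y ⟩
    z ∥ y          ≡⟨ ∥-comm z y ⟩
    y ∥ z          ∎

  ·-monoʳ-≤ : ∀ x {y z} → y ≤ z → x · y ≤ x · z
  ·-monoʳ-≤ x {y} {z} y≤z =
    ≤-trans (x≤x+y (x · y) (x · z)) (≤-respʳ-≡ (cong (x ·_) y≤z) (·-subdistribˡ x y z))

  ·-assoc-𝟘 : ∀ x y → x · (y · 𝟘) ≡ (x · y) · 𝟘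
  ·-assoc-𝟘 x y = begin
    x · (y · 𝟘)        ≡⟨ cong (λ t → x · (y · t)) (sym (·-zeroˡ 𝟘)) ⟩
    x · (y · (𝟘 · 𝟘))  ≡⟨ cl5 x y 𝟘 ⟩
    (x · y) · (𝟘 · 𝟘)  ≡⟨ cong ((x · y) ·_) (·-zeroˡ 𝟘) ⟩
    (x · y) · 𝟘        ∎

  ·𝟘≤1π : ∀ x → x · 𝟘 ≤ 1π
  ·𝟘≤1π x = ≤-respˡ-≡ (cl2 x) (x⊓y≤x 1π (x + 1π̄))

  U≡1π+1π̄ : U ≡ 1π + 1π̄
  U≡1π+1π̄ = begin
    U                ≡⟨ sym (·-identityˡ U) ⟩
    1σ · U           ≡⟨ sym (cl1 1σ) ⟩
    1σ · 1π + 1σ · 1π̄ ≡⟨ cong₂ _+_ (·-identityˡ 1π) (·-identityˡ 1π̄) ⟩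
    1π + 1π̄          ∎

  1π·𝟘≡1π : 1π · 𝟘 ≡ 1π
  1π·𝟘≡1π = trans (sym (cl2 1π)) (absorb-⊓+ 1π 1π̄)

  1π̄·𝟘≡𝟘 : 1π̄ · 𝟘 ≡ 𝟘
  1π̄·𝟘≡𝟘 = begin
    1π̄ · 𝟘           ≡⟨ sym (cl2 1π̄) ⟩
    1π ⊓ (1π̄ + 1π̄)   ≡⟨ cong (1π ⊓_) (+-idem 1π̄) ⟩
    1π ⊓ 1π̄          ≡⟨ cong (1π ⊓_) (sym (+-identity 1π̄)) ⟩
    1π ⊓ (𝟘 + 1π̄)    ≡⟨ cl2 𝟘 ⟩
    𝟘 · 𝟘            ≡⟨ ·-zeroˡ 𝟘 ⟩
    𝟘                ∎

  1σ⊓1π≡𝟘 : 1σ ⊓ 1π ≡ 𝟘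
  1σ⊓1π≡𝟘 = trans (⊓-comm 1σ 1π) (x≤𝟘⇒x≡𝟘 1π⊓1σ≤𝟘)
    where
    1π⊓1σ≤𝟘 : 1π ⊓ 1σ ≤ 𝟘
    1π⊓1σ≤𝟘 = ≤-respʳ-≡ (trans (cl2 1σ) (·-identityˡ 𝟘)) (⊓-monoʳ-≤ 1π (x≤x+y 1σ 1π̄))

  1σ≤1π̄ : 1σ ≤ 1π̄
  1σ≤1π̄ = x⊓y≡x⇒x≤y (begin
    1σ ⊓ 1π̄         ≡⟨ sym (⊓-+-disjointˡ 1π̄ 1σ⊓1π≡𝟘) ⟩
    1σ ⊓ (1π + 1π̄)  ≡⟨ cong (1σ ⊓_) (sym U≡1π+1π̄) ⟩
    1σ ⊓ U          ≡⟨ ⊓-comm 1σ U ⟩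
    U ⊓ 1σ          ≡⟨ ⊓-top 1σ ⟩
    1σ              ∎)

  ·1π≤1π : ∀ x → x · 1π ≤ 1π
  ·1π≤1π x = ≤-respˡ-≡ x·1π·𝟘≡x·1π (·𝟘≤1π (x · 1π))
    where
    x·1π·𝟘≡x·1π : (x · 1π) · 𝟘 ≡ x · 1π
    x·1π·𝟘≡x·1π = trans (sym (·-assoc-𝟘 x 1π)) (cong (x ·_) 1π·𝟘≡1π)

  1σ⊓·1π≡𝟘 : ∀ x → 1σ ⊓ x · 1π ≡ 𝟘
  1σ⊓·1π≡𝟘 x = ⊓≡𝟘-antimonoʳ (·1π≤1π x) 1σ⊓1π≡𝟘

  d≤1σ : ∀ x → d x ≤ 1σ
  d≤1σ x = ≤-respʳ-≡ (∥-identity 1σ) (∥-monoˡ-≤ 1σ (·1π≤1π x))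

  cl10-≤ : ∀ {y} → y ≤ 1π̄ → (y · 1π) ∥ 1σ ≡ 1σ ⊓ y · 1π̄
  cl10-≤ {y} y≤1π̄ =
    subst (λ t → (t · 1π) ∥ 1σ ≡ 1σ ⊓ t · 1π̄) (x≤y⇒x⊓y≡x y≤1π̄) (cl10 y)

  d≡1σ⊓∥1π̄ : ∀ x → d x ≡ 1σ ⊓ ((x · 1π) ∥ 1π̄)
  d≡1σ⊓∥1π̄ x = begin
    d x                  ≡⟨ cong (_∥ 1σ) (sym (trans (cl8 x 1π) (∥-identityʳ (x · 1π)))) ⟩
    (d x · 1π) ∥ 1σ      ≡⟨ cl10-≤ (≤-trans (d≤1σ x) 1σ≤1π̄) ⟩
    1σ ⊓ d x · 1π̄        ≡⟨ cong (1σ ⊓_) (cl8 x 1π̄) ⟩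
    1σ ⊓ (x · 1π) ∥ 1π̄   ∎

  d≡1σ⊓∥U : ∀ x → d x ≡ 1σ ⊓ ((x · 1π) ∥ U)
  d≡1σ⊓∥U x = sym (begin
    1σ ⊓ v ∥ U              ≡⟨ cong (λ t → 1σ ⊓ v ∥ t) U≡1π+1π̄ ⟩
    1σ ⊓ v ∥ (1π + 1π̄)      ≡⟨ cong (1σ ⊓_) (∥-distrib v 1π 1π̄) ⟩
    1σ ⊓ (v ∥ 1π + v ∥ 1π̄)  ≡⟨ cong (λ t → 1σ ⊓ (t + v ∥ 1π̄)) (∥-identityʳ v) ⟩
    1σ ⊓ (v + v ∥ 1π̄)       ≡⟨ ⊓-+-disjointˡ (v ∥ 1π̄) (1σ⊓·1π≡𝟘 x) ⟩
    1σ ⊓ v ∥ 1π̄             ≡⟨ sym (d≡1σ⊓∥1π̄ x) ⟩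
    d x                     ∎)
    where
    v : S
    v = x · 1π

  1π⊓·1π̄≤·1π : ∀ x → 1π ⊓ x · 1π̄ ≤ x · 1π
  1π⊓·1π̄≤·1π x = ≤-trans 1π⊓·1π̄≤·𝟘 (·-monoʳ-≤ x (+-identity 1π))
    where
    1π⊓·1π̄≤·𝟘 : 1π ⊓ x · 1π̄ ≤ x · 𝟘
    1π⊓·1π̄≤·𝟘 = ≤-respʳ-≡
      (trans (cl2 (x · 1π̄)) (trans (sym (·-assoc-𝟘 x 1π̄)) (cong (x ·_) 1π̄·𝟘≡𝟘)))
      (⊓-monoʳ-≤ 1π (x≤x+y (x · 1π̄) 1π̄))

  1π⊓·U≡·1π : ∀ x → 1π ⊓ x · U ≡ x · 1π
  1π⊓·U≡·1π x = begin
    1π ⊓ x · U                      ≡⟨ cong (1π ⊓_) (sym (cl1 x)) ⟩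
    1π ⊓ (x · 1π + x · 1π̄)          ≡⟨ distrib 1π (x · 1π) (x · 1π̄) ⟩
    (1π ⊓ x · 1π) + (1π ⊓ x · 1π̄)   ≡⟨ cong (_+ (1π ⊓ x · 1π̄)) 1π⊓·1π≡·1π ⟩
    x · 1π + (1π ⊓ x · 1π̄)          ≡⟨ +-comm (x · 1π) (1π ⊓ x · 1π̄) ⟩
    (1π ⊓ x · 1π̄) + x · 1π          ≡⟨ 1π⊓·1π̄≤·1π x ⟩
    x · 1π                          ∎
    where
    1π⊓·1π≡·1π : 1π ⊓ x · 1π ≡ x · 1π
    1π⊓·1π≡·1π = trans (⊓-comm 1π (x · 1π)) (x≤y⇒x⊓y≡x (·1π≤1π x))

lemma28 : ∀ {a : Level} (C : CLattice a) → let open CLattice C in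
    ∀ x → (d x ≡ 1σ ⊓ ((x · 1π) ∥ 1π̄))
        × (d x ≡ 1σ ⊓ ((x · 1π) ∥ U))
        × (d x ≡ (1π ⊓ x · U) ∥ 1σ)
lemma28 C x =
  d≡1σ⊓∥1π̄ x , d≡1σ⊓∥U x , cong (_∥ 1σ) (sym (1π⊓·U≡·1π x))
  where
  open CLattice C
  open CLatticeProperties C
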